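{- Let $p>3$ be a prime and, identifying $\mathbb{F}_p^*$ with the integers $\{1,\dots,p-1\}$, let $$A=\{x\in\mathbb{F}_p^*: p/3\le x\le 2p/3\}.$$ Then $$\frac{\log(p-1)}{\log 3}\le \mathrm{cov}(A)<3(\log p+1).$$
   Context: For $A\subseteq\mathbb{F}_p^*$, a set $B\subseteq\mathbb{F}_p^*$ is an $A$-covering set if $AB=\mathbb{F}_p^*$, where $AB=\{ab:a\in A,b\in B\}$ (product in the multiplicative group). $\mathrm{cov}(A)$ denotes the smallest size of an $A$-covering set. $\log$ is the natural logarithm. -}

module Defs where

open import Data.Nat using (ℕ; zero; suc; _+_; _*_; _∸_; _^_; _≤_; _<_)
open import Data.Fin using (Fin; toℕ)
open import Data.Fin.Subset using (Subset; _∈_; ∣_∣)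
open import Data.Product using (Σ; _×_; ∃)
open import Data.Sum using (_⊎_)
open import Relation.Binary.PropositionalEquality using (_≡_; _≢_)

NonZeroRes : {p : ℕ} → Fin p → Set
NonZeroRes x = toℕ x ≢ 0

-- A = { x ∈ F_p^* : p/3 ≤ x ≤ 2p/3 }  (real inequalities, cleared of denominators)
InA : (p : ℕ) → Fin p → Set
InA p x = NonZeroRes x × (p ≤ 3 * toℕ x) × (3 * toℕ x ≤ 2 * p)

MulIs : (p : ℕ) → Fin p → Fin p → Fin p → Set
MulIs p a b y = ∃ λ k → toℕ a * toℕ b ≡ toℕ y + k * p

IsCovering : (p : ℕ) → (Fin p → Set) → Subset p → Set
IsCovering p A B =
  ((b : Fin p) → b ∈ B → NonZeroRes b) ×
  ((y : Fin p) → NonZeroRes y →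
     Σ (Fin p) λ a → Σ (Fin p) λ b → A a × b ∈ B × MulIs p a b y)

IsCov : (p : ℕ) → (Fin p → Set) → ℕ → Set
IsCov p A c =
  (Σ (Subset p) λ B → IsCovering p A B × ∣ B ∣ ≡ c) ×
  ((B : Subset p) → IsCovering p A B → c ≤ ∣ B ∣)

-- log(p-1)/log 3 ≤ c   ⇔   p - 1 ≤ 3^c   (exp/log monotone)
LogLowerBound : ℕ → ℕ → Set
LogLowerBound p c = p ∸ 1 ≤ 3 ^ c

-- c < 3(log p + 1)  ⇔  c ≤ 3  or  e^(c-3) < p^3.
-- e is the strictly decreasing limit of (1 + 1/(n+1))^(n+2), so for k ≥ 1,
-- e^k < p^3  ⇔  ∃ n, ((n+2)/(n+1))^((n+2)k) < p^3,  stated over ℕ with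
-- denominators cleared.
ExpBelow : ℕ → ℕ → Set
ExpBelow k q = ∃ λ n → (n + 2) ^ ((n + 2) * k) < q * (n + 1) ^ ((n + 2) * k)

LogUpperBound : ℕ → ℕ → Set
LogUpperBound p c = (c ≤ 3) ⊎ ExpBelow (c ∸ 3) (p ^ 3)

{-# OPTIONS --safe #-}
module Submission where

-- Lower bound: attach to y ∈ F_p the word in {0,1,2}^B whose letter at b is the third of
-- {0,…,p-1} containing y/b. If y < y' had the same word, write y' - y = ab with a ∈ A, b ∈ B;
-- then y'/b = y/b + a, but adding an element of the middle third always changes the third of
-- a residue. So y ↦ word is injective on F_p, and p ≤ 3^|B|.
--
-- Upper bound: if 2^m ≤ p < 2^(m+1) then {2^-j : j ≤ m} is an A-covering set. Doubling y
-- (or p - y, since A = -A) at most m times lands in the middle third without wrapping around,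
-- so some a = 2^j y lies in A and y = a 2^-j. Hence cov(A) ≤ m + 1 ≤ log₂ p + 1.

open import Defs
open import Data.Bool using (true; false)
open import Data.Empty using (⊥; ⊥-elim)
open import Data.Fin as Fin using (Fin; zero; suc; toℕ; fromℕ<; combine)
open import Data.Fin.Properties
  using (toℕ<n; toℕ-fromℕ<; toℕ-injective; combine-injectiveˡ; combine-injectiveʳ; pigeonhole)
open import Data.Fin.Subset using (Subset; _∈_; ∣_∣; _∪_; ⁅_⁆)
open import Data.Fin.Subset.Properties using (x∈⁅x⁆; x∈⁅y⁆⇒x≡y; x∈p∪q⁺; x∈p∪q⁻; ∣⁅x⁆∣≡1)
open import Data.Nat
open import Data.Nat.Properties
open import Data.Nat.DivMod
open import Data.Nat.Primality using (Prime)
open import Data.Nat.Coprimality using (prime⇒coprime; coprime-Bézout)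
open import Data.Nat.GCD using (module Bézout)
open import Data.Nat.Tactic.RingSolver using (solve-∀)
open import Data.Product using (∃; ∃₂; _×_; _,_; proj₁; proj₂)
open import Data.Sum using (inj₁; inj₂)
open import Data.Vec using (_∷_; []; here; there)
open import Function using (_∘_)
open import Relation.Binary.PropositionalEquality
open import Relation.Nullary using (¬_; Dec; yes; no)

private
  variable
    a b c m n x y : ℕ

code : ∀ {n k} (s : Subset n) → (Fin n → Fin k) → Fin (k ^ ∣ s ∣)
code []          f = zero
code (true ∷ s)  f = combine (f zero) (code s (f ∘ suc))
code (false ∷ s) f = code s (f ∘ suc)

code-injective : ∀ {n k} (s : Subset n) (f g : Fin n → Fin k) →
                 code s f ≡ code s g → ∀ {i} → i ∈ s → f i ≡ g i
code-injective (true ∷ s)  f g eq here        = combine-injectiveˡ (f zero) _ (g zero) _ eq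
code-injective (true ∷ s)  f g eq (there i∈s) =
  code-injective s (f ∘ suc) (g ∘ suc) (combine-injectiveʳ (f zero) _ (g zero) _ eq) i∈s
code-injective (false ∷ s) f g eq (there i∈s) = code-injective s (f ∘ suc) (g ∘ suc) eq i∈s

pigeonhole-on : ∀ {m n k} (s : Subset n) → k ^ ∣ s ∣ < m → (f : Fin m → Fin n → Fin k) →
                ∃₂ λ i j → i Fin.< j × (∀ {x} → x ∈ s → f i x ≡ f j x)
pigeonhole-on s k^∣s∣<m f with i , j , i<j , eq ← pigeonhole k^∣s∣<m (code s ∘ f)
  = i , j , i<j , code-injective s (f i) (f j) eq

module _ {p : ℕ} .{{_ : NonZero p}} where

  %-cong-+ : a % p ≡ b % p → m % p ≡ n % p → (a + m) % p ≡ (b + n) % p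
  %-cong-+ {a} {b} {m} {n} eq₁ eq₂ = begin
    (a + m) % p           ≡⟨ %-distribˡ-+ a m p ⟩
    (a % p + m % p) % p   ≡⟨ cong₂ (λ u v → (u + v) % p) eq₁ eq₂ ⟩
    (b % p + n % p) % p   ≡⟨ %-distribˡ-+ b n p ⟨
    (b + n) % p           ∎
    where open ≡-Reasoning

  %-cong-* : a % p ≡ b % p → m % p ≡ n % p → (a * m) % p ≡ (b * n) % p
  %-cong-* {a} {b} {m} {n} eq₁ eq₂ = begin
    (a * m) % p             ≡⟨ %-distribˡ-* a m p ⟩
    (a % p * (m % p)) % p   ≡⟨ cong₂ (λ u v → (u * v) % p) eq₁ eq₂ ⟩
    (b % p * (n % p)) % p   ≡⟨ %-distribˡ-* b n p ⟨
    (b * n) % p             ∎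
    where open ≡-Reasoning

  *-inverseʳ-% : (b * c) % p ≡ 1 % p → (a * b * c) % p ≡ a % p
  *-inverseʳ-% {b} {c} {a} bc≡1 = begin
    (a * b * c) % p     ≡⟨ cong (_% p) (*-assoc a b c) ⟩
    (a * (b * c)) % p   ≡⟨ %-cong-* {a} refl bc≡1 ⟩
    (a * 1) % p         ≡⟨ cong (_% p) (*-identityʳ a) ⟩
    a % p               ∎
    where open ≡-Reasoning

  ^-inverse-% : ∀ j → (x * y) % p ≡ 1 % p → (x ^ j * y ^ j) % p ≡ 1 % p
  ^-inverse-% zero    xy≡1 = refl
  ^-inverse-% {x} {y} (suc j) xy≡1 = begin
    (x * x ^ j * (y * y ^ j)) % p   ≡⟨ cong (_% p) (interchange x (x ^ j) y (y ^ j)) ⟩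
    (x * y * (x ^ j * y ^ j)) % p   ≡⟨ %-cong-* xy≡1 (^-inverse-% j xy≡1) ⟩
    (1 * 1) % p                     ∎
    where
    open ≡-Reasoning
    interchange : ∀ a b c d → a * b * (c * d) ≡ a * c * (b * d)
    interchange = solve-∀

  %-invertible⇒≢0 : 1 < p → (x * y) % p ≡ 1 % p → y % p ≢ 0
  %-invertible⇒≢0 {x} {y} 1<p xy≡1 y≡0 = 0≢1+n (begin
    0             ≡⟨ m*n%n≡0 0 p ⟨
    0 % p         ≡⟨ cong (_% p) (*-zeroʳ x) ⟨
    (x * 0) % p   ≡⟨ %-cong-* {x} refl (trans y≡0 (sym (m*n%n≡0 0 p))) ⟨
    (x * y) % p   ≡⟨ xy≡1 ⟩
    1 % p         ≡⟨ m<n⇒m%n≡m 1<p ⟩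
    1             ∎)
    where open ≡-Reasoning

  %-shift-by-product : ∀ a b c d y → (a * b) % p ≡ d % p → (b * c) % p ≡ 1 % p →
                       ((y + d) * c) % p ≡ (y * c + a) % p
  %-shift-by-product a b c d y ab≡d bc≡1 = begin
    ((y + d) * c) % p     ≡⟨ cong (_% p) (*-distribʳ-+ c y d) ⟩
    (y * c + d * c) % p   ≡⟨ %-cong-+ {y * c} refl dc≡a ⟩
    (y * c + a) % p       ∎
    where
    open ≡-Reasoning
    dc≡a : (d * c) % p ≡ a % p
    dc≡a = trans (%-cong-* (sym ab≡d) refl) (*-inverseʳ-% bc≡1)

  m%n+n≡m : p ≤ m → m < p + p → m % p + p ≡ m
  m%n+n≡m {m} p≤m m<2p = begin
    m % p + p         ≡⟨ cong (_+ p) (m≤n⇒[n∸m]%m≡n%m p≤m) ⟨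
    (m ∸ p) % p + p   ≡⟨ cong (_+ p) (m<n⇒m%n≡m m∸p<p) ⟩
    m ∸ p + p         ≡⟨ m∸n+n≡m p≤m ⟩
    m                 ∎
    where
    open ≡-Reasoning
    m∸p<p : m ∸ p < p
    m∸p<p = +-cancelʳ-< p (m ∸ p) p (subst (_< p + p) (sym (m∸n+n≡m p≤m)) m<2p)

  %-complement : ∀ w x k → w + x ≡ k * p → 0 < x → x ≤ p → w % p ≡ p ∸ x
  %-complement w x zero    w+x≡0 0<x _ = ⊥-elim (<⇒≢ 0<x (sym (m+n≡0⇒n≡0 w w+x≡0)))
  %-complement w x (suc k) w+x≡[1+k]p 0<x x≤p = begin
    w % p                 ≡⟨ cong (_% p) w≡[p∸x]+kp ⟩
    (p ∸ x + k * p) % p   ≡⟨ [m+kn]%n≡m%n (p ∸ x) k p ⟩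
    (p ∸ x) % p           ≡⟨ m<n⇒m%n≡m (∸-monoʳ-< 0<x x≤p) ⟩
    p ∸ x                 ∎
    where
    open ≡-Reasoning
    regroup : ∀ u x v → u + x + v ≡ u + v + x
    regroup = solve-∀
    w≡[p∸x]+kp : w ≡ p ∸ x + k * p
    w≡[p∸x]+kp = +-cancelʳ-≡ x w (p ∸ x + k * p) (begin
      w + x               ≡⟨ w+x≡[1+k]p ⟩
      p + k * p           ≡⟨ cong (_+ k * p) (m∸n+n≡m x≤p) ⟨
      p ∸ x + x + k * p   ≡⟨ regroup (p ∸ x) x (k * p) ⟩
      p ∸ x + k * p + x   ∎)

  MulIs⇒% : ∀ {u v w} → MulIs p u v w → (toℕ u * toℕ v) % p ≡ toℕ w % p
  MulIs⇒% {w = w} (k , uv≡w+kp) = trans (cong (_% p) uv≡w+kp) ([m+kn]%n≡m%n (toℕ w) k p)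

  %⇒MulIs : ∀ {u v w} → (toℕ u * toℕ v) % p ≡ toℕ w % p → MulIs p u v w
  %⇒MulIs {u} {v} {w} uv≡w = uv / p , (begin
    uv                    ≡⟨ m≡m%n+[m/n]*n uv p ⟩
    uv % p + uv / p * p   ≡⟨ cong (_+ uv / p * p) (trans uv≡w (m<n⇒m%n≡m (toℕ<n w))) ⟩
    toℕ w + uv / p * p    ∎)
    where
    open ≡-Reasoning
    uv = toℕ u * toℕ v

prime⇒%-inverse : ∀ {p b} .{{_ : NonZero p}} → Prime p → 0 < b → b < p →
                  ∃ λ c → (b * c) % p ≡ 1 % p
prime⇒%-inverse {suc q} {b} p-prime 0<b b<p
  with coprime-Bézout (prime⇒coprime p-prime {{>-nonZero 0<b}} b<p)
... | Bézout.-+ x y 1+xp≡yb = y , (begin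
  (b * y) % suc q           ≡⟨ cong (_% suc q) (trans (*-comm b y) (sym 1+xp≡yb)) ⟩
  (1 + x * suc q) % suc q   ≡⟨ [m+kn]%n≡m%n 1 x (suc q) ⟩
  1 % suc q                 ∎)
  where open ≡-Reasoning
... | Bézout.+- x y 1+yb≡xp = y * q , (begin
  (b * (y * q)) % suc q           ≡⟨ [m+n]%n≡m%n (b * (y * q)) (suc q) ⟨
  (b * (y * q) + suc q) % suc q   ≡⟨ cong (_% suc q) byq+p≡1+qxp ⟩
  (1 + q * x * suc q) % suc q     ≡⟨ [m+kn]%n≡m%n 1 (q * x) (suc q) ⟩
  1 % suc q                       ∎)
  where
  open ≡-Reasoning
  regroup : ∀ b y q → b * (y * q) + suc q ≡ 1 + q * (1 + y * b)
  regroup = solve-∀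
  -- y b ≡ -1 and q ≡ -1, so y q is the inverse of b
  byq+p≡1+qxp : b * (y * q) + suc q ≡ 1 + q * x * suc q
  byq+p≡1+qxp = begin
    b * (y * q) + suc q   ≡⟨ regroup b y q ⟩
    1 + q * (1 + y * b)   ≡⟨ cong (λ t → 1 + q * t) 1+yb≡xp ⟩
    1 + q * (x * suc q)   ≡⟨ cong suc (*-assoc q x (suc q)) ⟨
    1 + q * x * suc q     ∎

MiddleThird : ℕ → ℕ → Set
MiddleThird p x = p ≤ 3 * x × 3 * x ≤ 2 * p

module _ {p : ℕ} .{{_ : NonZero p}} where

  middleThird⇒<p : MiddleThird p x → x < p
  middleThird⇒<p {x} (_ , 3x≤2p) = *-cancelˡ-< 3 x p (≤-<-trans 3x≤2p (*-monoˡ-< p (n<1+n 2)))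

  middleThird⇒≢0 : MiddleThird p x → x ≢ 0
  middleThird⇒≢0 (p≤3x , _) refl = <⇒≱ (>-nonZero⁻¹ p) p≤3x

  middleThird-reflect : MiddleThird p x → MiddleThird p (p ∸ x)
  middleThird-reflect {x} x-middle@(p≤3x , 3x≤2p) = p≤3[p∸x] , 3[p∸x]≤2p
    where
    open ≤-Reasoning
    3[p∸x]+3x≡3p : 3 * (p ∸ x) + 3 * x ≡ 3 * p
    3[p∸x]+3x≡3p = trans (sym (*-distribˡ-+ 3 (p ∸ x) x))
                         (cong (3 *_) (m∸n+n≡m (<⇒≤ (middleThird⇒<p {x = x} x-middle))))
    3p≡p+2p : ∀ p → 3 * p ≡ p + 2 * p
    3p≡p+2p = solve-∀
    p≤3[p∸x] : p ≤ 3 * (p ∸ x)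
    p≤3[p∸x] = +-cancelʳ-≤ (3 * x) p (3 * (p ∸ x)) (begin
      p + 3 * x             ≤⟨ +-monoʳ-≤ p 3x≤2p ⟩
      p + 2 * p             ≡⟨ 3p≡p+2p p ⟨
      3 * p                 ≡⟨ 3[p∸x]+3x≡3p ⟨
      3 * (p ∸ x) + 3 * x   ∎)
    3[p∸x]≤2p : 3 * (p ∸ x) ≤ 2 * p
    3[p∸x]≤2p = +-cancelʳ-≤ (3 * x) (3 * (p ∸ x)) (2 * p) (begin
      3 * (p ∸ x) + 3 * x   ≡⟨ 3[p∸x]+3x≡3p ⟩
      3 * p                 ≡⟨ 3p≡p+2p p ⟩
      p + 2 * p             ≡⟨ +-comm p (2 * p) ⟩
      2 * p + p             ≤⟨ +-monoʳ-≤ (2 * p) p≤3x ⟩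
      2 * p + 3 * x         ∎)

/-≡⇒<+ : ∀ m o n .{{_ : NonZero n}} → m / n ≡ o / n → o < m + n
/-≡⇒<+ m o n m/n≡o/n = begin-strict
  o                   ≡⟨ m≡m%n+[m/n]*n o n ⟩
  o % n + o / n * n   <⟨ +-monoˡ-< (o / n * n) (m%n<n o n) ⟩
  n + o / n * n       ≡⟨ cong (λ k → n + k * n) m/n≡o/n ⟨
  n + m / n * n       ≤⟨ +-monoʳ-≤ n (m/n*n≤m m n) ⟩
  n + m               ≡⟨ +-comm n m ⟩
  m + n               ∎
  where open ≤-Reasoning

third : (p : ℕ) .{{_ : NonZero p}} → ℕ → Fin 3
third p x = fromℕ< (m<n*o⇒m/o<n (*-monoʳ-< 3 (m%n<n x p)))

module _ {p : ℕ} .{{_ : NonZero p}} where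

  third-cong : x % p ≡ y % p → third p x ≡ third p y
  third-cong {x} {y} eq = toℕ-injective (begin
    toℕ (third p x)   ≡⟨ toℕ-fromℕ< _ ⟩
    3 * (x % p) / p   ≡⟨ cong (λ r → 3 * r / p) eq ⟩
    3 * (y % p) / p   ≡⟨ toℕ-fromℕ< _ ⟨
    toℕ (third p y)   ∎)
    where open ≡-Reasoning

  third-≡⇒close : third p x ≡ third p y → 3 * (y % p) < 3 * (x % p) + p
  third-≡⇒close {x} {y} eq = /-≡⇒<+ (3 * (x % p)) (3 * (y % p)) p
    (trans (sym (toℕ-fromℕ< _)) (trans (cong toℕ eq) (toℕ-fromℕ< _)))

  third-shift : MiddleThird p a → third p x ≢ third p (x + a)
  third-shift {a} {x} a-middle@(p≤3a , 3a≤2p) eq = apart (r + a <? p)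
    where
    r = x % p
    r' = (x + a) % p
    r'≡[r+a]%p : r' ≡ (r + a) % p
    r'≡[r+a]%p = %-cong-+ (sym (m%n%n≡m%n x p)) refl
    apart : Dec (r + a < p) → ⊥
    apart (yes r+a<p) = <⇒≱ (third-≡⇒close eq) (begin
      3 * r + p       ≤⟨ +-monoʳ-≤ (3 * r) p≤3a ⟩
      3 * r + 3 * a   ≡⟨ *-distribˡ-+ 3 r a ⟨
      3 * (r + a)     ≡⟨ cong (3 *_) (trans r'≡[r+a]%p (m<n⇒m%n≡m r+a<p)) ⟨
      3 * r'          ∎)
      where open ≤-Reasoning
    apart (no r+a≮p) = <⇒≱ (third-≡⇒close (sym eq)) (+-cancelʳ-≤ (2 * p) (3 * r' + p) (3 * r) (begin
      3 * r' + p + 2 * p   ≡⟨ regroup r' p ⟩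
      3 * (r' + p)         ≡⟨ cong (3 *_) (trans (cong (_+ p) r'≡[r+a]%p) (m%n+n≡m p≤r+a r+a<2p)) ⟩
      3 * (r + a)          ≡⟨ *-distribˡ-+ 3 r a ⟩
      3 * r + 3 * a        ≤⟨ +-monoʳ-≤ (3 * r) 3a≤2p ⟩
      3 * r + 2 * p        ∎))
      where
      open ≤-Reasoning
      regroup : ∀ r' p → 3 * r' + p + 2 * p ≡ 3 * (r' + p)
      regroup = solve-∀
      p≤r+a : p ≤ r + a
      p≤r+a = ≮⇒≥ r+a≮p
      r+a<2p : r + a < p + p
      r+a<2p = +-mono-< (m%n<n x p) (middleThird⇒<p {x = a} a-middle)

module _ {p : ℕ} .{{_ : NonZero p}} (p-prime : Prime p) where

  inverse : Fin p → ℕ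
  inverse b with toℕ b ≟ 0
  ... | yes _  = 0
  ... | no b≢0 = proj₁ (prime⇒%-inverse p-prime (n≢0⇒n>0 b≢0) (toℕ<n b))

  inverse-correct : ∀ {b} → NonZeroRes b → (toℕ b * inverse b) % p ≡ 1 % p
  inverse-correct {b} b≢0 with toℕ b ≟ 0
  ... | yes b≡0 = ⊥-elim (b≢0 b≡0)
  ... | no b≢0  = proj₂ (prime⇒%-inverse p-prime (n≢0⇒n>0 b≢0) (toℕ<n b))

  covering⇒p≤3^∣B∣ : (B : Subset p) → IsCovering p (InA p) B → p ≤ 3 ^ ∣ B ∣
  covering⇒p≤3^∣B∣ B (B-nonzero , covers) = ≮⇒≥ λ 3^∣B∣<p →
    let i , j , i<j , agree = pigeonhole-on B 3^∣B∣<p digits in separated i<j agree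
    where
    digits : Fin p → Fin p → Fin 3
    digits y b = third p (toℕ y * inverse b)

    separated : ∀ {i j} → i Fin.< j → ¬ (∀ {b} → b ∈ B → digits i b ≡ digits j b)
    separated {i} {j} i<j agree = apart (covers (fromℕ< gap<p) gap≢0)
      where
      gap = toℕ j ∸ toℕ i
      gap<p : gap < p
      gap<p = ≤-<-trans (m∸n≤m (toℕ j) (toℕ i)) (toℕ<n j)
      gap≢0 : NonZeroRes (fromℕ< gap<p)
      gap≢0 gap≡0 = <⇒≱ i<j (m∸n≡0⇒m≤n (trans (sym (toℕ-fromℕ< gap<p)) gap≡0))
      apart : ¬ ∃₂ λ a b → InA p a × b ∈ B × MulIs p a b (fromℕ< gap<p)
      apart (a , b , (_ , a-middle) , b∈B , ab≡gap) =
        third-shift {a = toℕ a} {x = toℕ i * b⁻¹} a-middle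
          (trans (agree b∈B) (third-cong {x = toℕ j * b⁻¹} j/b≡i/b+a))
        where
        open ≡-Reasoning
        b⁻¹ = inverse b
        ab%p≡gap%p : (toℕ a * toℕ b) % p ≡ gap % p
        ab%p≡gap%p = trans (MulIs⇒% {u = a} {v = b} ab≡gap) (cong (_% p) (toℕ-fromℕ< gap<p))
        j/b≡i/b+a : (toℕ j * b⁻¹) % p ≡ (toℕ i * b⁻¹ + toℕ a) % p
        j/b≡i/b+a = begin
          (toℕ j * b⁻¹) % p           ≡⟨ cong (λ t → (t * b⁻¹) % p) (m+[n∸m]≡n (<⇒≤ i<j)) ⟨
          ((toℕ i + gap) * b⁻¹) % p   ≡⟨ %-shift-by-product (toℕ a) (toℕ b) b⁻¹ gap (toℕ i)
                                           ab%p≡gap%p (inverse-correct (B-nonzero b b∈B)) ⟩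
          (toℕ i * b⁻¹ + toℕ a) % p   ∎

∣p∪q∣≤∣p∣+∣q∣ : ∀ {n} (p q : Subset n) → ∣ p ∪ q ∣ ≤ ∣ p ∣ + ∣ q ∣
∣p∪q∣≤∣p∣+∣q∣ []          []          = z≤n
∣p∪q∣≤∣p∣+∣q∣ (true ∷ p)  (true ∷ q)  =
  s≤s (≤-trans (m≤n⇒m≤1+n (∣p∪q∣≤∣p∣+∣q∣ p q)) (≤-reflexive (sym (+-suc ∣ p ∣ ∣ q ∣))))
∣p∪q∣≤∣p∣+∣q∣ (true ∷ p)  (false ∷ q) = s≤s (∣p∪q∣≤∣p∣+∣q∣ p q)
∣p∪q∣≤∣p∣+∣q∣ (false ∷ p) (true ∷ q)  =
  ≤-trans (s≤s (∣p∪q∣≤∣p∣+∣q∣ p q)) (≤-reflexive (sym (+-suc ∣ p ∣ ∣ q ∣)))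
∣p∪q∣≤∣p∣+∣q∣ (false ∷ p) (false ∷ q) = ∣p∪q∣≤∣p∣+∣q∣ p q

imageUpTo : ∀ {n} → (ℕ → Fin n) → ℕ → Subset n
imageUpTo f zero    = ⁅ f zero ⁆
imageUpTo f (suc t) = ⁅ f (suc t) ⁆ ∪ imageUpTo f t

module _ {n} (f : ℕ → Fin n) where

  ∣imageUpTo∣≤ : ∀ t → ∣ imageUpTo f t ∣ ≤ suc t
  ∣imageUpTo∣≤ zero    = ≤-reflexive (∣⁅x⁆∣≡1 (f zero))
  ∣imageUpTo∣≤ (suc t) = begin
    ∣ ⁅ f (suc t) ⁆ ∪ imageUpTo f t ∣       ≤⟨ ∣p∪q∣≤∣p∣+∣q∣ ⁅ f (suc t) ⁆ (imageUpTo f t) ⟩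
    ∣ ⁅ f (suc t) ⁆ ∣ + ∣ imageUpTo f t ∣   ≡⟨ cong (_+ ∣ imageUpTo f t ∣) (∣⁅x⁆∣≡1 (f (suc t))) ⟩
    suc ∣ imageUpTo f t ∣                   ≤⟨ s≤s (∣imageUpTo∣≤ t) ⟩
    suc (suc t)                             ∎
    where open ≤-Reasoning

  ∈imageUpTo⁺ : ∀ {j t} → j ≤ t → f j ∈ imageUpTo f t
  ∈imageUpTo⁺ {zero} {zero}  _ = x∈⁅x⁆ (f zero)
  ∈imageUpTo⁺ {j}    {suc t} j≤1+t with j ≟ suc t
  ... | yes refl = x∈p∪q⁺ (inj₁ (x∈⁅x⁆ (f (suc t))))
  ... | no j≢1+t = x∈p∪q⁺ {p = ⁅ f (suc t) ⁆} (inj₂ (∈imageUpTo⁺ (s≤s⁻¹ (≤∧≢⇒< j≤1+t j≢1+t))))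

  ∈imageUpTo⁻ : ∀ {i} t → i ∈ imageUpTo f t → ∃ λ j → j ≤ t × i ≡ f j
  ∈imageUpTo⁻ zero    i∈ = zero , z≤n , x∈⁅y⁆⇒x≡y (f zero) i∈
  ∈imageUpTo⁻ (suc t) i∈ with x∈p∪q⁻ ⁅ f (suc t) ⁆ (imageUpTo f t) i∈
  ... | inj₁ i∈⁅f[1+t]⁆ = suc t , ≤-refl , x∈⁅y⁆⇒x≡y (f (suc t)) i∈⁅f[1+t]⁆
  ... | inj₂ i∈image with j , j≤t , i≡fj ← ∈imageUpTo⁻ t i∈image = j , m≤n⇒m≤1+n j≤t , i≡fj

power-of-2-bracket : ∀ n → ∃ λ m → 2 ^ m ≤ suc n × suc n < 2 ^ suc m
power-of-2-bracket zero = zero , ≤-refl , s≤s (s≤s z≤n)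
power-of-2-bracket (suc n) with m , 2^m≤1+n , 1+n<2^[1+m] ← power-of-2-bracket n
  with suc (suc n) <? 2 ^ suc m
... | yes 2+n<2^[1+m] = m , m≤n⇒m≤1+n 2^m≤1+n , 2+n<2^[1+m]
... | no 2+n≮2^[1+m]  = suc m , ≮⇒≥ 2+n≮2^[1+m] ,
                        ≤-<-trans 1+n<2^[1+m] (^-monoʳ-< 2 (s≤s (s≤s z≤n)) (n<1+n (suc m)))

2^t*[2*x]≡2^[1+t]*x : ∀ t x → 2 ^ t * (2 * x) ≡ 2 ^ suc t * x
2^t*[2*x]≡2^[1+t]*x t x = trans (sym (*-assoc (2 ^ t) 2 x)) (cong (_* x) (*-comm (2 ^ t) 2))

doubling-reaches : ∀ t → x < 2 * n → n ≤ 2 ^ t * x →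
                   ∃ λ j → j ≤ t × n ≤ 2 ^ j * x × 2 ^ j * x < 2 * n
doubling-reaches {x} {n} t x<2n n≤2^tx with n ≤? x
... | yes n≤x = zero , z≤n , subst (n ≤_) (sym (*-identityˡ x)) n≤x ,
                             subst (_< 2 * n) (sym (*-identityˡ x)) x<2n
doubling-reaches {x} {n} zero x<2n n≤1x | no n≰x = ⊥-elim (n≰x (subst (n ≤_) (*-identityˡ x) n≤1x))
doubling-reaches {x} {n} (suc t) x<2n n≤2^[1+t]x | no n≰x
  with j , j≤t , n≤2^j2x , 2^j2x<2n ←
         doubling-reaches t (*-monoʳ-< 2 (≰⇒> n≰x)) (subst (n ≤_) (sym (2^t*[2*x]≡2^[1+t]*x t x)) n≤2^[1+t]x)
  = suc j , s≤s j≤t , subst (n ≤_) (2^t*[2*x]≡2^[1+t]*x j x) n≤2^j2x ,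
                      subst (_< 2 * n) (2^t*[2*x]≡2^[1+t]*x j x) 2^j2x<2n

module _ {p : ℕ} .{{_ : NonZero p}} where

  doubling-into-middleThird : 0 < y → 3 * y < 2 * p → p < 2 ^ suc m →
                              ∃ λ j → j ≤ m × MiddleThird p (2 ^ j * y)
  doubling-into-middleThird {y} {m} 0<y 3y<2p p<2^[1+m] = rescale (doubling-reaches m 3y<2p p≤2^m*3y)
    where
    instance _ = >-nonZero 0<y
    p≤2^m*3y : p ≤ 2 ^ m * (3 * y)
    p≤2^m*3y = begin
      p                 ≤⟨ <⇒≤ p<2^[1+m] ⟩
      2 * 2 ^ m         ≡⟨ *-comm 2 (2 ^ m) ⟩
      2 ^ m * 2         ≤⟨ *-monoʳ-≤ (2 ^ m) (≤-trans (n≤1+n 2) (m≤m*n 3 y)) ⟩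
      2 ^ m * (3 * y)   ∎
      where open ≤-Reasoning
    u*3y≡3*uy : ∀ u y → u * (3 * y) ≡ 3 * (u * y)
    u*3y≡3*uy = solve-∀
    rescale : (∃ λ j → j ≤ m × p ≤ 2 ^ j * (3 * y) × 2 ^ j * (3 * y) < 2 * p) →
              ∃ λ j → j ≤ m × MiddleThird p (2 ^ j * y)
    rescale (j , j≤m , lower , upper) =
      j , j≤m , subst (p ≤_) (u*3y≡3*uy (2 ^ j) y) lower ,
                subst (_≤ 2 * p) (u*3y≡3*uy (2 ^ j) y) (<⇒≤ upper)

  2p≤3y⇒3[p∸y]<2p : y ≤ p → 2 * p ≤ 3 * y → 3 * (p ∸ y) < 2 * p
  2p≤3y⇒3[p∸y]<2p {y} y≤p 2p≤3y = +-cancelʳ-< (2 * p) (3 * (p ∸ y)) (2 * p) (begin-strict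
    3 * (p ∸ y) + 2 * p   ≤⟨ +-monoʳ-≤ (3 * (p ∸ y)) 2p≤3y ⟩
    3 * (p ∸ y) + 3 * y   ≡⟨ *-distribˡ-+ 3 (p ∸ y) y ⟨
    3 * (p ∸ y + y)       ≡⟨ cong (3 *_) (m∸n+n≡m y≤p) ⟩
    3 * p                 <⟨ *-monoˡ-< p (n<1+n 3) ⟩
    4 * p                 ≡⟨ 4p≡2p+2p p ⟩
    2 * p + 2 * p         ∎)
    where
    open ≤-Reasoning
    4p≡2p+2p : ∀ p → 4 * p ≡ 2 * p + 2 * p
    4p≡2p+2p = solve-∀

  doubling-hits-middleThird : 0 < y → y < p → p < 2 ^ suc m →
                              ∃ λ j → j ≤ m × MiddleThird p ((y * 2 ^ j) % p)
  doubling-hits-middleThird {y} {m} 0<y y<p p<2^[1+m] with 3 * y <? 2 * p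
  ... | yes 3y<2p = direct (doubling-into-middleThird 0<y 3y<2p p<2^[1+m])
    where
    direct : (∃ λ j → j ≤ m × MiddleThird p (2 ^ j * y)) →
             ∃ λ j → j ≤ m × MiddleThird p ((y * 2 ^ j) % p)
    direct (j , j≤m , mid) = j , j≤m , subst (MiddleThird p) (sym (begin
      (y * 2 ^ j) % p   ≡⟨ cong (_% p) (*-comm y (2 ^ j)) ⟩
      (2 ^ j * y) % p   ≡⟨ m<n⇒m%n≡m (middleThird⇒<p {x = 2 ^ j * y} mid) ⟩
      2 ^ j * y         ∎)) mid
      where open ≡-Reasoning
  ... | no 3y≮2p =
    reflected (doubling-into-middleThird 0<z (2p≤3y⇒3[p∸y]<2p (<⇒≤ y<p) (≮⇒≥ 3y≮2p)) p<2^[1+m])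
    where
    z = p ∸ y
    z+y≡p : z + y ≡ p
    z+y≡p = m∸n+n≡m (<⇒≤ y<p)
    0<z : 0 < z
    0<z = m<n⇒0<n∸m y<p
    reflected : (∃ λ j → j ≤ m × MiddleThird p (2 ^ j * z)) →
                ∃ λ j → j ≤ m × MiddleThird p ((y * 2 ^ j) % p)
    reflected (j , j≤m , mid) =
      j , j≤m , subst (MiddleThird p) (sym y2^j%p≡p∸2^jz) (middleThird-reflect {x = 2 ^ j * z} mid)
      where
      y*u+u*z≡u*[z+y] : ∀ u y z → y * u + u * z ≡ u * (z + y)
      y*u+u*z≡u*[z+y] = solve-∀
      y2^j%p≡p∸2^jz : (y * 2 ^ j) % p ≡ p ∸ 2 ^ j * z
      y2^j%p≡p∸2^jz = %-complement (y * 2 ^ j) (2 ^ j * z) (2 ^ j)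
        (trans (y*u+u*z≡u*[z+y] (2 ^ j) y z) (cong (2 ^ j *_) z+y≡p))
        (n≢0⇒n>0 (middleThird⇒≢0 {x = 2 ^ j * z} mid)) (<⇒≤ (middleThird⇒<p {x = 2 ^ j * z} mid))

module _ {p : ℕ} .{{_ : NonZero p}} (p-prime : Prime p) (2<p : 2 < p) where

  half : ℕ
  half = proj₁ (prime⇒%-inverse p-prime (s≤s z≤n) 2<p)

  2^j*half^j≡1 : ∀ j → (2 ^ j * half ^ j) % p ≡ 1 % p
  2^j*half^j≡1 j = ^-inverse-% j (proj₂ (prime⇒%-inverse p-prime (s≤s z≤n) 2<p))

  halving : ℕ → Fin p
  halving j = fromℕ< (m%n<n (half ^ j) p)

  halving-nonzero : ∀ j → NonZeroRes (halving j)
  halving-nonzero j halving≡0 = %-invertible⇒≢0 {x = 2 ^ j} (<-trans (s≤s (s≤s z≤n)) 2<p)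
    (2^j*half^j≡1 j) (trans (sym (toℕ-fromℕ< _)) halving≡0)

  halvings-cover : ∀ m → p < 2 ^ suc m → IsCovering p (InA p) (imageUpTo halving m)
  halvings-cover m p<2^[1+m] = nonzero , covered
    where
    nonzero : ∀ b → b ∈ imageUpTo halving m → NonZeroRes b
    nonzero b b∈ with j , _ , refl ← ∈imageUpTo⁻ halving m b∈ = halving-nonzero j

    covered : ∀ y → NonZeroRes y → ∃₂ λ a b → InA p a × b ∈ imageUpTo halving m × MulIs p a b y
    covered y y≢0 = witness (doubling-hits-middleThird (n≢0⇒n>0 y≢0) (toℕ<n y) p<2^[1+m])
      where
      witness : (∃ λ j → j ≤ m × MiddleThird p ((toℕ y * 2 ^ j) % p)) →
                ∃₂ λ a b → InA p a × b ∈ imageUpTo halving m × MulIs p a b y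
      witness (j , j≤m , y2^j-middle) =
        doubled , halving j , (middleThird⇒≢0 {x = toℕ doubled} doubled-middle , doubled-middle) ,
        ∈imageUpTo⁺ halving j≤m , %⇒MulIs {u = doubled} {v = halving j} {w = y} doubled*halving≡y
        where
        open ≡-Reasoning
        doubled : Fin p
        doubled = fromℕ< (m%n<n (toℕ y * 2 ^ j) p)
        toℕ-doubled : toℕ doubled ≡ (toℕ y * 2 ^ j) % p
        toℕ-doubled = toℕ-fromℕ< _
        doubled-middle : MiddleThird p (toℕ doubled)
        doubled-middle = subst (MiddleThird p) (sym toℕ-doubled) y2^j-middle
        doubled*halving≡y : (toℕ doubled * toℕ (halving j)) % p ≡ toℕ y % p
        doubled*halving≡y = begin
          (toℕ doubled * toℕ (halving j)) % p          ≡⟨ cong₂ (λ u v → (u * v) % p) toℕ-doubled (toℕ-fromℕ< _) ⟩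
          ((toℕ y * 2 ^ j) % p * (half ^ j % p)) % p   ≡⟨ %-distribˡ-* (toℕ y * 2 ^ j) (half ^ j) p ⟨
          (toℕ y * 2 ^ j * half ^ j) % p               ≡⟨ *-inverseʳ-% (2^j*half^j≡1 j) ⟩
          toℕ y % p                                    ∎

2^[2*e]<p^3 : ∀ {e m p} → e ≤ m → 2 ^ m ≤ p → 1 < p → 2 ^ (2 * e) < p ^ 3
2^[2*e]<p^3 {e} {m} {p} e≤m 2^m≤p 1<p = begin-strict
  2 ^ (2 * e)         ≤⟨ ^-monoʳ-≤ 2 (*-monoʳ-≤ 2 e≤m) ⟩
  2 ^ (m + (m + 0))   ≡⟨ cong (λ k → 2 ^ (m + k)) (+-identityʳ m) ⟩
  2 ^ (m + m)         ≡⟨ ^-distribˡ-+-* 2 m m ⟩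
  2 ^ m * 2 ^ m       ≤⟨ *-mono-≤ 2^m≤p 2^m≤p ⟩
  p * p               <⟨ *-monoʳ-< p (m<m*n p p 1<p) ⟩
  p * (p * p)         ≡⟨ cong (λ k → p * (p * k)) (*-identityʳ p) ⟨
  p ^ 3               ∎
  where
  open ≤-Reasoning
  instance _ = >-nonZero (<-trans z<s 1<p)

-- The witness n = 0 only uses e < 4, i.e. e^k < 4^k = 2^(2k).
ExpBelow-from-4^ : ∀ {k q} → 2 ^ (2 * k) < q → ExpBelow k q
ExpBelow-from-4^ {k} {q} 4^k<q = 0 , subst (2 ^ (2 * k) <_) (sym q*1^2k≡q) 4^k<q
  where
  q*1^2k≡q : q * 1 ^ (2 * k) ≡ q
  q*1^2k≡q = trans (cong (q *_) (^-zeroˡ (2 * k))) (*-identityʳ q)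

mainTheorem5 : (p : ℕ) → Prime p → 3 < p → (c : ℕ) → IsCov p (InA p) c →
    LogLowerBound p c × LogUpperBound p c
mainTheorem5 p@(suc q) p-prime 3<p c ((B , B-covers , ∣B∣≡c) , c-minimal)
  with m , 2^m≤p , p<2^[1+m] ← power-of-2-bracket q
  = ≤-trans (n≤1+n q) p≤3^c , inj₂ (ExpBelow-from-4^ (2^[2*e]<p^3 c∸3≤m 2^m≤p 1<p))
  where
  p≤3^c : p ≤ 3 ^ c
  p≤3^c = subst (λ k → p ≤ 3 ^ k) ∣B∣≡c (covering⇒p≤3^∣B∣ p-prime B B-covers)
  2<p : 2 < p
  2<p = <-trans (n<1+n 2) 3<p
  1<p : 1 < p
  1<p = <-trans (n<1+n 1) 2<p
  c≤1+m : c ≤ suc m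
  c≤1+m = ≤-trans (c-minimal _ (halvings-cover p-prime 2<p m p<2^[1+m]))
                  (∣imageUpTo∣≤ (halving p-prime 2<p) m)
  c∸3≤m : c ∸ 3 ≤ m
  c∸3≤m = ≤-trans (∸-monoʳ-≤ c (s≤s z≤n)) (∸-monoˡ-≤ 1 c≤1+m)
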